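{- Let $n\ge 3m$, let $x\in\binom{\Omega}{m}$ where $|\Omega|=n$, let $\mathcal{T}=\mathcal{T}(x)$ be the Terwilliger algebra of $J(n,m,m+1)$ with respect to $x$, and let $\mathcal{M}$ be the space defined in the context. Then $\mathcal{T}$ is a subalgebra of $\mathcal{M}$ (in particular $\mathcal{T}\subseteq\mathcal{M}$).
   Context: $J(n,m,m+1)$ is the bipartite graph with vertex set $X=\binom{\Omega}{m}\cup\binom{\Omega}{m+1}$ ($\binom{S}{k}$ = set of $k$-subsets of $S$), $y\in\binom{\Omega}{m}$ adjacent to $z\in\binom{\Omega}{m+1}$ iff $y\subseteq z$; $A$ is its adjacency matrix. $\Gamma_k(x)$ is the set of vertices at distance $k$ from $x$; for $n\ge 2m+1$ the maximal distance from $x$ is $2m+1$, and $\Gamma_{2i}(x)=\{y\in\binom{\Omega}{m}:|x\cap y|=m-i\}$, $\Gamma_{2i+1}(x)=\{z\in\binom{\Omega}{m+1}:|x\cap z|=m-i\}$. $E^*_k$ is the diagonal $0/1$ matrix in $\mathrm{Mat}_X(\mathbb{C})$ with $(y,y)$-entry $1$ iff $y\in\Gamma_k(x)$. The Terwilliger algebra $\mathcal{T}(x)$ is the subalgebra of $\mathrm{Mat}_X(\mathbb{C})$ generated by $A,E^*_0,\dots,E^*_{2m+1}$. A vertex $y\in\Gamma_k(x)$ is identified with $(y\cap x,y\setminus x)\in\binom{x}{m-\lfloor k/2\rfloor}\times\binom{\Omega\setminus x}{\lceil k/2\rceil}$, so a matrix indexed by $\Gamma_k(x)\times\Gamma_l(x)$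 may be a Kronecker product $P\otimes Q$, $(P\otimes Q)_{(\alpha,\beta),(\alpha',\beta')}=P_{\alpha\alpha'}Q_{\beta\beta'}$. For a set $V$ of size $v$, $C^l_{i,j}(v)$ is the matrix with rows indexed by $\binom{V}{i}$, columns by $\binom{V}{j}$, entry $\binom{|y\cap z|}{l}$; here $V=x$ ($v=m$) in the first factor and $V=\Omega\setminus x$ ($v=n-m$) in the second. For a matrix $M$ indexed by $\Gamma_i(x)\times\Gamma_j(x)$, $L(M)\in\mathrm{Mat}_X(\mathbb{C})$ is the matrix whose $\Gamma_i(x)\times\Gamma_j(x)$ block is $M$ and all other blocks are $0$. For $0\le i,j\le 2m+1$, $\mathcal{M}_{i,j}=\mathrm{Span}\{C^l_{m-\lfloor i/2\rfloor,m-\lfloor j/2\rfloor}(m)\otimes C^s_{\lceil i/2\rceil,\lceil j/2\rceil}(n-m): 0\le l\le\min(m-\lfloor i/2\rfloor,m-\lfloor j/2\rfloor),\ 0\le s\le\min(\lceil i/2\rceil,\lceil j/2\rceil)\}$ and $\mathcal{M}=\bigoplus_{i,j=0}^{2m+1}L(\mathcal{M}_{i,j})$. -}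

module Defs where

open import Level using (Level; _⊔_)
open import Algebra.Bundles using (CommutativeRing)
open import Data.Nat as ℕ using (ℕ; zero; suc; _≤_; _∸_; _⊓_; ⌊_/2⌋; ⌈_/2⌉)
open import Data.Nat.Properties using (_≟_; _≤?_)
open import Data.Nat.Combinatorics using (_C_)
open import Data.Bool using (Bool; true; false)
open import Data.Vec using ([]; _∷_)
import Data.Vec.Properties
import Data.Bool
open import Data.List using (List; []; _∷_; map; _++_; foldr)
open import Data.Fin.Subset using (Subset; _∩_; _─_; _⊆_; ∣_∣)
open import Data.Fin.Subset.Properties using (_⊆?_)
open import Data.Product using (Σ; _×_; _,_; ∃)
open import Data.Sum using (_⊎_)
open import Relation.Nullary using (¬_; Dec; yes; no)
open import Relation.Nullary.Decidable using (_×-dec_; _⊎-dec_)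
open import Relation.Binary.PropositionalEquality using (_≡_)

eqSub? : {n : ℕ} (y z : Subset n) → Dec (y ≡ z)
eqSub? = Data.Vec.Properties.≡-dec Data.Bool._≟_

allSubsets : (n : ℕ) → List (Subset n)
allSubsets zero = [] ∷ []
allSubsets (suc n) = map (true ∷_) (allSubsets n) ++ map (false ∷_) (allSubsets n)

module _ {c ℓ : Level} (R : CommutativeRing c ℓ) where
  open CommutativeRing R using (_≈_; _+_; _*_; 0#; 1#) renaming (Carrier to F)

  ℕ→F : ℕ → F
  ℕ→F zero = 0#
  ℕ→F (suc k) = 1# + ℕ→F k

  IsCharZeroField : Set (c ⊔ ℓ)
  IsCharZeroField =
    (¬ (1# ≈ 0#)) ×
    ((a : F) → ¬ (a ≈ 0#) → Σ F (λ b → (a * b) ≈ 1#)) ×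
    ((k : ℕ) → ¬ (ℕ→F (suc k) ≈ 0#))

  -- finite sum over a list and over the range 0..k (inclusive)
  sumL : {A : Set} → List A → (A → F) → F
  sumL xs f = foldr (λ a acc → f a + acc) 0# xs

  sumTo : ℕ → (ℕ → F) → F
  sumTo zero f = f zero
  sumTo (suc k) f = f (suc k) + sumTo k f

  module J (n m : ℕ) (x : Subset n) where

    -- matrices indexed by subsets of Ω; those of interest are supported on X × X
    Mat : Set c
    Mat = Subset n → Subset n → F

    _≈M_ : Mat → Mat → Set ℓ
    P ≈M Q = ∀ y z → P y z ≈ Q y z

    _·M_ : Mat → Mat → Mat
    (P ·M Q) y z = sumL (allSubsets n) (λ w → P y w * Q w z)

    _+M_ : Mat → Mat → Mat
    (P +M Q) y z = P y z + Q y z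

    _•M_ : F → Mat → Mat
    (a •M P) y z = a * P y z

    inX? : (y : Subset n) → Dec (∣ y ∣ ≡ m ⊎ ∣ y ∣ ≡ suc m)
    inX? y = (∣ y ∣ ≟ m) ⊎-dec (∣ y ∣ ≟ suc m)

    adjA : Mat
    adjA y z with ((∣ y ∣ ≟ m) ×-dec (∣ z ∣ ≟ suc m) ×-dec (y ⊆? z))
                  ⊎-dec ((∣ y ∣ ≟ suc m) ×-dec (∣ z ∣ ≟ m) ×-dec (z ⊆? y))
    ... | yes _ = 1#
    ... | no _ = 0#

    idX : Mat
    idX y z with inX? y | eqSub? y z
    ... | yes _ | yes _ = 1#
    ... | _ | _ = 0#

    -- distance from x of a vertex y ∈ X (as given in the context):
    -- Γ_{2i}(x) = {y m-set : |x∩y| = m-i}, Γ_{2i+1}(x) = {z (m+1)-set : |x∩z| = m-i}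
    level : Subset n → ℕ
    level y with ∣ y ∣ ≟ m
    ... | yes _ = 2 ℕ.* (m ∸ ∣ x ∩ y ∣)
    ... | no _ = suc (2 ℕ.* (m ∸ ∣ x ∩ y ∣))

    inΓ? : (k : ℕ) (y : Subset n) → Dec ((∣ y ∣ ≡ m ⊎ ∣ y ∣ ≡ suc m) × level y ≡ k)
    inΓ? k y = inX? y ×-dec (level y ≟ k)

    Estar : ℕ → Mat
    Estar k y z with inΓ? k y | eqSub? y z
    ... | yes _ | yes _ = 1#
    ... | _ | _ = 0#

    -- L(C^l_{m-⌊i/2⌋, m-⌊j/2⌋}(m) ⊗ C^s_{⌈i/2⌉,⌈j/2⌉}(n-m)), using the identification
    -- y ↦ (y ∩ x, y \ x)
    basis : (i j l s : ℕ) → Mat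
    basis i j l s y z with inΓ? i y | inΓ? j z
    ... | yes _ | yes _ = ℕ→F (∣ (y ∩ x) ∩ (z ∩ x) ∣ C l) * ℕ→F (∣ (y ─ x) ∩ (z ─ x) ∣ C s)
    ... | _ | _ = 0#

    InM : Mat → Set (c ⊔ ℓ)
    InM P = Σ (ℕ → ℕ → ℕ → ℕ → F) λ coef →
      P ≈M (λ y z →
        sumTo (suc (2 ℕ.* m)) λ i →
        sumTo (suc (2 ℕ.* m)) λ j →
        sumTo ((m ∸ ⌊ i /2⌋) ⊓ (m ∸ ⌊ j /2⌋)) λ l →
        sumTo (⌈ i /2⌉ ⊓ ⌈ j /2⌉) λ s →
        coef i j l s * basis i j l s y z)

    data InT : Mat → Set (c ⊔ ℓ) where
      genA : InT adjA
      genE : ∀ k → k ≤ suc (2 ℕ.* m) → InT (Estar k)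
      genI : InT idX
      add  : ∀ {P Q} → InT P → InT Q → InT (P +M Q)
      scal : ∀ a {P} → InT P → InT (a •M P)
      mul  : ∀ {P Q} → InT P → InT Q → InT (P ·M Q)
      resp : ∀ {P Q} → P ≈M Q → InT P → InT Q

module Submission where

-- Call a matrix indexed by subsets of Ω a Venn matrix if it vanishes off X × X and its (y, z) entry
-- depends only on the Venn diagram of x, y, z, i.e. on the multiset of columns (x_ω, y_ω, z_ω).
-- The generators A, E*_k, I of 𝓣 are Venn matrices, and Venn matrices are closed under sums,
-- scalars and products: the (y, z) entry of P Q is a sum over w of a function of the Venn diagrams
-- of (x, y, w) and (x, w, z), and choosing the w-bit column by column shows that this sum depends
-- only on the multiset of columns of (x, y, z). Conversely, for y ∈ Γ_i(x) and z ∈ Γ_j(x) the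
-- Venn diagram is recovered by inclusion–exclusion from i, j, p = |y ∩ z ∩ x| and q = |y ∩ z ─ x|,
-- and Newton's forward-difference formula expands any function of (p, q) in the products of
-- binomials C(p, l) C(q, s), which are the entries of the spanning matrices of 𝓜. Hence 𝓜 is
-- exactly the space of Venn matrices, so it contains 𝓣 and is closed under multiplication.

open import Level using (Level; _⊔_)
open import Algebra.Bundles using (CommutativeRing)
import Algebra.Properties.AbelianGroup as AbelianGroupProperties
import Algebra.Properties.CommutativeSemigroup as CommutativeSemigroupProperties
open import Data.Bool using (Bool; true; false; if_then_else_)
open import Data.Empty using (⊥-elim)
open import Data.Fin.Subset using (Subset; _∩_; _─_; _⊆_; ⊤; ∣_∣)
open import Data.Fin.Subset.Properties
  using (_⊆?_; s⊆s; out⊆; drop-∷-⊆; ⊆-refl; ⊆-antisym; ∩-comm; ∣⊤∣≡n; ∣p∩q∣≤∣p∣; ∣p∩q∣≤∣p∣⊓∣q∣)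
open import Data.List using (List; []; _∷_; map; _++_; foldr; replicate)
open import Data.List.Relation.Binary.Permutation.Propositional
  using (_↭_; prep; swap; ↭-sym) renaming (refl to ↭-refl; trans to ↭-trans)
open import Data.List.Relation.Binary.Permutation.Propositional.Properties
  using (map⁺; ++⁺ˡ; ++⁺ʳ; shift)
open import Data.Maybe using (nothing)
open import Data.Nat using (ℕ; zero; suc; _≤_; z≤n; s≤s; _∸_; _⊓_; ⌊_/2⌋; ⌈_/2⌉)
import Data.Nat as ℕ
import Data.Nat.Properties as ℕₚ
open import Data.Nat.Properties using (_≟_)
open import Data.Nat.Combinatorics using (_C_; k>n⇒nCk≡0; nCk+nC[k+1]≡[n+1]C[k+1])
open import Data.Product using (_×_; _,_; proj₁; proj₂)
import Data.Product as Product
open import Data.Sum using (_⊎_; inj₁; inj₂)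
import Data.Sum as Sum
open import Data.Vec using (Vec; []; _∷_; head; here)
open import Function using (_∘_)
open import Relation.Binary.PropositionalEquality as ≡ using (_≡_; _≢_)
open import Relation.Nullary using (¬_; Dec; yes; no)
open import Relation.Nullary.Decidable using (_×-dec_; _⊎-dec_)
open import Tactic.RingSolver.Core.AlmostCommutativeRing using (AlmostCommutativeRing; fromCommutativeRing)
import Tactic.RingSolver as RingSolver
open import Defs

module Tallies where
  open import Data.Nat using (_+_)
  open import Data.Nat.Properties using (+-assoc; +-comm)
  open ≡ using (refl; sym; cong)
  open ≡.≡-Reasoning

  Letter : ℕ → Set
  Letter = Vec Bool

  -- A finite multiset of letters, stored as the tree of multiplicities indexed by the letters, so
  -- that it carries no ordering and equal multisets are equal tallies.
  Tally : ℕ → Set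
  Tally zero = ℕ
  Tally (suc d) = Tally d × Tally d

  empty : ∀ {d} → Tally d
  empty {zero} = 0
  empty {suc d} = empty , empty

  insert : ∀ {d} → Letter d → Tally d → Tally d
  insert [] k = suc k
  insert (true ∷ a) (l , r) = insert a l , r
  insert (false ∷ a) (l , r) = l , insert a r

  insert-comm : ∀ {d} (a b : Letter d) t → insert a (insert b t) ≡ insert b (insert a t)
  insert-comm [] [] k = refl
  insert-comm (true ∷ a) (true ∷ b) (l , r) = cong (_, r) (insert-comm a b l)
  insert-comm (true ∷ a) (false ∷ b) (l , r) = refl
  insert-comm (false ∷ a) (true ∷ b) (l , r) = refl
  insert-comm (false ∷ a) (false ∷ b) (l , r) = cong (l ,_) (insert-comm a b r)

  tally : ∀ {d} → List (Letter d) → Tally d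
  tally = foldr insert empty

  elements : ∀ {d} → Tally d → List (Letter d)
  elements {zero} k = replicate k []
  elements {suc d} (l , r) = map (true ∷_) (elements l) ++ map (false ∷_) (elements r)

  elements-empty : ∀ d → elements (empty {d}) ≡ []
  elements-empty zero = refl
  elements-empty (suc d) rewrite elements-empty d = refl

  elements-insert : ∀ {d} (a : Letter d) t → a ∷ elements t ↭ elements (insert a t)
  elements-insert [] k = ↭-refl
  elements-insert (true ∷ a) (l , r) =
    ++⁺ʳ (map (false ∷_) (elements r)) (map⁺ (true ∷_) (elements-insert a l))
  elements-insert (false ∷ a) (l , r) = ↭-trans
    (↭-sym (shift (false ∷ a) (map (true ∷_) (elements l)) (map (false ∷_) (elements r))))
    (++⁺ˡ (map (true ∷_) (elements l)) (map⁺ (false ∷_) (elements-insert a r)))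

  ↭-elements-tally : ∀ {d} (L : List (Letter d)) → L ↭ elements (tally L)
  ↭-elements-tally {d} [] rewrite elements-empty d = ↭-refl
  ↭-elements-tally (a ∷ L) = ↭-trans (prep a (↭-elements-tally L)) (elements-insert a (tally L))

  count : ∀ {d} → (Letter d → Bool) → Tally d → ℕ
  count {zero} φ k = if φ [] then k else 0
  count {suc d} φ (l , r) = count (φ ∘ (true ∷_)) l + count (φ ∘ (false ∷_)) r

  count-empty : ∀ {d} (φ : Letter d → Bool) → count φ empty ≡ 0
  count-empty {zero} φ with φ []
  ... | true = refl
  ... | false = refl
  count-empty {suc d} φ rewrite count-empty (φ ∘ (true ∷_)) | count-empty (φ ∘ (false ∷_)) = refl

  count-insert : ∀ {d} (φ : Letter d → Bool) a t →
    count φ (insert a t) ≡ (if φ a then 1 else 0) + count φ t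
  count-insert {zero} φ [] k with φ []
  ... | true = refl
  ... | false = refl
  count-insert {suc d} φ (true ∷ a) (l , r) = begin
    count φₗ (insert a l) + count φᵣ r              ≡⟨ cong (_+ count φᵣ r) (count-insert φₗ a l) ⟩
    ((if φₗ a then 1 else 0) + count φₗ l) + count φᵣ r ≡⟨ +-assoc (if φₗ a then 1 else 0) _ _ ⟩
    (if φₗ a then 1 else 0) + (count φₗ l + count φᵣ r) ∎
    where φₗ = φ ∘ (true ∷_); φᵣ = φ ∘ (false ∷_)
  count-insert {suc d} φ (false ∷ a) (l , r) = begin
    count φₗ l + count φᵣ (insert a r)                  ≡⟨ cong (count φₗ l +_) (count-insert φᵣ a r) ⟩
    count φₗ l + ((if φᵣ a then 1 else 0) + count φᵣ r) ≡⟨ sym (+-assoc (count φₗ l) _ _) ⟩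
    (count φₗ l + (if φᵣ a then 1 else 0)) + count φᵣ r ≡⟨ cong (_+ count φᵣ r) (+-comm (count φₗ l) _) ⟩
    ((if φᵣ a then 1 else 0) + count φₗ l) + count φᵣ r ≡⟨ +-assoc (if φᵣ a then 1 else 0) _ _ ⟩
    (if φᵣ a then 1 else 0) + (count φₗ l + count φᵣ r) ∎
    where φₗ = φ ∘ (true ∷_); φᵣ = φ ∘ (false ∷_)

open Tallies

module VennDiagrams where
  open import Data.Nat using (_+_)
  open import Data.Nat.Properties using (m+n∸m≡n; +-suc; m+n≡0⇒m≡0; m+n≡0⇒n≡0)
  open import Data.Nat.Tactic.RingSolver using (solve-∀)
  open ≡ using (refl; sym; trans; cong)
  open ≡.≡-Reasoning

  columns : ∀ {k} → Subset k → Subset k → Subset k → List (Letter 3)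
  columns [] [] [] = []
  columns (a ∷ x) (b ∷ y) (c ∷ z) = (a ∷ b ∷ c ∷ []) ∷ columns x y z

  venn : ∀ {k} → Subset k → Subset k → Subset k → Tally 3
  venn x y z = tally (columns x y z)

  Region : Set
  Region = ∀ {k} → Subset k → Subset k → Subset k → Subset k

  atLetter : Region → Letter 3 → Bool
  atLetter S (a ∷ b ∷ c ∷ []) = head (S (a ∷ []) (b ∷ []) (c ∷ []))

  Pointwise : Region → Set
  Pointwise S = ∀ {k} a b c (x y z : Subset k) →
    S (a ∷ x) (b ∷ y) (c ∷ z) ≡ atLetter S (a ∷ b ∷ c ∷ []) ∷ S x y z

  ∣∷∣ : ∀ {k} b (s : Subset k) → ∣ b ∷ s ∣ ≡ (if b then 1 else 0) + ∣ s ∣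
  ∣∷∣ true s = refl
  ∣∷∣ false s = refl

  size : Region → Tally 3 → ℕ
  size S = count (atLetter S)

  ∣region∣≡size-venn : (S : Region) → Pointwise S → ∀ {k} (x y z : Subset k) →
    ∣ S x y z ∣ ≡ size S (venn x y z)
  ∣region∣≡size-venn S S-∷ [] [] [] with S {0} [] [] []
  ... | [] = sym (count-empty (atLetter S))
  ∣region∣≡size-venn S S-∷ (a ∷ x) (b ∷ y) (c ∷ z) = begin
    ∣ S (a ∷ x) (b ∷ y) (c ∷ z) ∣                         ≡⟨ cong ∣_∣ (S-∷ a b c x y z) ⟩
    ∣ ψ abc ∷ S x y z ∣                                    ≡⟨ ∣∷∣ (ψ abc) (S x y z) ⟩
    (if ψ abc then 1 else 0) + ∣ S x y z ∣                 ≡⟨ cong (_ +_) (∣region∣≡size-venn S S-∷ x y z) ⟩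
    (if ψ abc then 1 else 0) + count ψ (venn x y z)        ≡⟨ sym (count-insert ψ abc (venn x y z)) ⟩
    count ψ (venn (a ∷ x) (b ∷ y) (c ∷ z))                 ∎
    where ψ = atLetter S; abc = a ∷ b ∷ c ∷ []

  ⟦x⟧ ⟦y⟧ ⟦z⟧ ⟦Ω⟧ ⟦x∩y⟧ ⟦x∩z⟧ ⟦y─x⟧ ⟦z─x⟧ ⟦y─z⟧ ⟦z─y⟧ ⟦y∩z∩x⟧ ⟦y∩z─x⟧ : Region
  ⟦x⟧ x y z = x
  ⟦y⟧ x y z = y
  ⟦z⟧ x y z = z
  ⟦Ω⟧ x y z = ⊤
  ⟦x∩y⟧ x y z = x ∩ y
  ⟦x∩z⟧ x y z = x ∩ z
  ⟦y─x⟧ x y z = y ─ x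
  ⟦z─x⟧ x y z = z ─ x
  ⟦y─z⟧ x y z = y ─ z
  ⟦z─y⟧ x y z = z ─ y
  ⟦y∩z∩x⟧ x y z = (y ∩ x) ∩ (z ∩ x)
  ⟦y∩z─x⟧ x y z = (y ─ x) ∩ (z ─ x)

  -- Inclusion–exclusion: the cells of a Venn tally of (x, y, z) from the sizes of x, Ω, x∩y, x∩z,
  -- y─x, z─x, y∩z∩x and y∩z─x. Cells are ordered by membership in x, then y, then z.
  reconstruct : (∣x∣ ∣Ω∣ ∣x∩y∣ ∣x∩z∣ ∣y─x∣ ∣z─x∣ ∣y∩z∩x∣ ∣y∩z─x∣ : ℕ) → Tally 3
  reconstruct ∣x∣ ∣Ω∣ ∣x∩y∣ ∣x∩z∣ ∣y─x∣ ∣z─x∣ p q =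
    (((p , ∣x∩y∣ ∸ p) , (∣x∩z∣ ∸ p , ∣x∣ ∸ (∣x∩y∣ + ∣x∩z∣ ∸ p))) ,
     ((q , ∣y─x∣ ∸ q) , (∣z─x∣ ∸ q , (∣Ω∣ ∸ ∣x∣) ∸ (∣y─x∣ + ∣z─x∣ ∸ q))))

  a+b+c+d∸[a+b+[a+c]∸a]≡d : ∀ a b c d → a + b + c + d ∸ (a + b + (a + c) ∸ a) ≡ d
  a+b+c+d∸[a+b+[a+c]∸a]≡d a b c d = begin
    a + b + c + d ∸ (a + b + (a + c) ∸ a)   ≡⟨ cong (λ u → a + b + c + d ∸ (u ∸ a)) (regroup a b c) ⟩
    a + b + c + d ∸ (a + (a + b + c) ∸ a)   ≡⟨ cong (a + b + c + d ∸_) (m+n∸m≡n a (a + b + c)) ⟩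
    a + b + c + d ∸ (a + b + c)             ≡⟨ m+n∸m≡n (a + b + c) d ⟩
    d                                       ∎
    where
    regroup : ∀ a b c → a + b + (a + c) ≡ a + (a + b + c)
    regroup = solve-∀

  reconstruct-cells : ∀ {a b c d e f g h ∣x∣ ∣Ω∣ ∣x∩y∣ ∣x∩z∣ ∣y─x∣ ∣z─x∣ ∣y∩z∩x∣ ∣y∩z─x∣} →
    ∣x∣ ≡ a + b + c + d → ∣Ω∣ ≡ a + b + c + d + (e + f + g + h) →
    ∣x∩y∣ ≡ a + b → ∣x∩z∣ ≡ a + c → ∣y─x∣ ≡ e + f → ∣z─x∣ ≡ e + g → ∣y∩z∩x∣ ≡ a → ∣y∩z─x∣ ≡ e →
    (((a , b) , (c , d)) , ((e , f) , (g , h))) ≡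
    reconstruct ∣x∣ ∣Ω∣ ∣x∩y∣ ∣x∩z∣ ∣y─x∣ ∣z─x∣ ∣y∩z∩x∣ ∣y∩z─x∣
  reconstruct-cells {a} {b} {c} {d} {e} {f} {g} {h} refl refl refl refl refl refl refl refl
    rewrite m+n∸m≡n a b | m+n∸m≡n a c | a+b+c+d∸[a+b+[a+c]∸a]≡d a b c d
          | m+n∸m≡n e f | m+n∸m≡n e g
          | m+n∸m≡n (a + b + c + d) (e + f + g + h) | a+b+c+d∸[a+b+[a+c]∸a]≡d e f g h = refl

  tally≡reconstruct : ∀ t {∣x∣ ∣Ω∣ ∣x∩y∣ ∣x∩z∣ ∣y─x∣ ∣z─x∣ ∣y∩z∩x∣ ∣y∩z─x∣} →
    size ⟦x⟧ t ≡ ∣x∣ → size ⟦Ω⟧ t ≡ ∣Ω∣ → size ⟦x∩y⟧ t ≡ ∣x∩y∣ → size ⟦x∩z⟧ t ≡ ∣x∩z∣ →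
    size ⟦y─x⟧ t ≡ ∣y─x∣ → size ⟦z─x⟧ t ≡ ∣z─x∣ → size ⟦y∩z∩x⟧ t ≡ ∣y∩z∩x∣ → size ⟦y∩z─x⟧ t ≡ ∣y∩z─x∣ →
    t ≡ reconstruct ∣x∣ ∣Ω∣ ∣x∩y∣ ∣x∩z∣ ∣y─x∣ ∣z─x∣ ∣y∩z∩x∣ ∣y∩z─x∣
  tally≡reconstruct (((a , b) , (c , d)) , ((e , f) , (g , h))) refl refl refl refl refl refl refl refl =
    reconstruct-cells (∣x∣ a b c d) (∣Ω∣ a b c d e f g h) (∣x∩y∣ a b) (∣x∩z∣ a c)
                      (∣y─x∣ e f) (∣z─x∣ e g) (∣y∩z∩x∣ a) (∣y∩z─x∣ e)
    where
    -- the region sizes of an explicit tally, in the shape in which `count` computes them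
    ∣x∣ : ∀ a b c d → ((a + b) + (c + d)) + 0 ≡ a + b + c + d
    ∣x∣ = solve-∀
    ∣Ω∣ : ∀ a b c d e f g h → ((a + b) + (c + d)) + ((e + f) + (g + h)) ≡ a + b + c + d + (e + f + g + h)
    ∣Ω∣ = solve-∀
    ∣x∩y∣ : ∀ a b → ((a + b) + 0) + 0 ≡ a + b
    ∣x∩y∣ = solve-∀
    ∣x∩z∣ : ∀ a c → ((a + 0) + (c + 0)) + 0 ≡ a + c
    ∣x∩z∣ = solve-∀
    ∣y─x∣ : ∀ e f → (e + f) + 0 ≡ e + f
    ∣y─x∣ = solve-∀
    ∣z─x∣ : ∀ e g → (e + 0) + (g + 0) ≡ e + g
    ∣z─x∣ = solve-∀
    ∣y∩z∩x∣ : ∀ a → ((a + 0) + 0) + 0 ≡ a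
    ∣y∩z∩x∣ = solve-∀
    ∣y∩z─x∣ : ∀ e → (e + 0) + 0 ≡ e
    ∣y∩z─x∣ = solve-∀

  ∣q∣≡∣p∩q∣+∣q─p∣ : ∀ {k} (p q : Subset k) → ∣ q ∣ ≡ ∣ p ∩ q ∣ + ∣ q ─ p ∣
  ∣q∣≡∣p∩q∣+∣q─p∣ [] [] = refl
  ∣q∣≡∣p∩q∣+∣q─p∣ (true ∷ p) (true ∷ q) = cong suc (∣q∣≡∣p∩q∣+∣q─p∣ p q)
  ∣q∣≡∣p∩q∣+∣q─p∣ (true ∷ p) (false ∷ q) = ∣q∣≡∣p∩q∣+∣q─p∣ p q
  ∣q∣≡∣p∩q∣+∣q─p∣ (false ∷ p) (true ∷ q) = trans (cong suc (∣q∣≡∣p∩q∣+∣q─p∣ p q)) (sym (+-suc _ _))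
  ∣q∣≡∣p∩q∣+∣q─p∣ (false ∷ p) (false ∷ q) = ∣q∣≡∣p∩q∣+∣q─p∣ p q

  p⊆q⇒∣p─q∣≡0 : ∀ {k} (p q : Subset k) → p ⊆ q → ∣ p ─ q ∣ ≡ 0
  p⊆q⇒∣p─q∣≡0 [] [] _ = refl
  p⊆q⇒∣p─q∣≡0 (true ∷ p) (true ∷ q) p⊆q = p⊆q⇒∣p─q∣≡0 p q (drop-∷-⊆ p⊆q)
  p⊆q⇒∣p─q∣≡0 (true ∷ p) (false ∷ q) p⊆q with p⊆q here
  ... | ()
  p⊆q⇒∣p─q∣≡0 (false ∷ p) (true ∷ q) p⊆q = p⊆q⇒∣p─q∣≡0 p q (drop-∷-⊆ p⊆q)
  p⊆q⇒∣p─q∣≡0 (false ∷ p) (false ∷ q) p⊆q = p⊆q⇒∣p─q∣≡0 p q (drop-∷-⊆ p⊆q)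

  ∣p─q∣≡0⇒p⊆q : ∀ {k} (p q : Subset k) → ∣ p ─ q ∣ ≡ 0 → p ⊆ q
  ∣p─q∣≡0⇒p⊆q [] [] _ ()
  ∣p─q∣≡0⇒p⊆q (true ∷ p) (true ∷ q) e = s⊆s (∣p─q∣≡0⇒p⊆q p q e)
  ∣p─q∣≡0⇒p⊆q (false ∷ p) (true ∷ q) e = out⊆ (∣p─q∣≡0⇒p⊆q p q e)
  ∣p─q∣≡0⇒p⊆q (false ∷ p) (false ∷ q) e = out⊆ (∣p─q∣≡0⇒p⊆q p q e)

  ∣p─p∣≡0 : ∀ {k} (p : Subset k) → ∣ p ─ p ∣ ≡ 0
  ∣p─p∣≡0 p = p⊆q⇒∣p─q∣≡0 p p ⊆-refl

  ∣p─q∣+∣q─p∣≡0⇒p≡q : ∀ {k} (p q : Subset k) → ∣ p ─ q ∣ + ∣ q ─ p ∣ ≡ 0 → p ≡ q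
  ∣p─q∣+∣q─p∣≡0⇒p≡q p q e = ⊆-antisym (∣p─q∣≡0⇒p⊆q p q (m+n≡0⇒m≡0 _ e)) (∣p─q∣≡0⇒p⊆q q p (m+n≡0⇒n≡0 _ e))

open VennDiagrams

⌊2r/2⌋≡r : ∀ r → ⌊ 2 ℕ.* r /2⌋ ≡ r
⌊2r/2⌋≡r r = ≡.trans (≡.cong (λ r′ → ⌊ r ℕ.+ r′ /2⌋) (ℕₚ.+-identityʳ r)) (≡.sym (ℕₚ.n≡⌊n+n/2⌋ r))

⌈2r/2⌉≡r : ∀ r → ⌈ 2 ℕ.* r /2⌉ ≡ r
⌈2r/2⌉≡r r = ≡.trans (≡.cong (λ r′ → ⌈ r ℕ.+ r′ /2⌉) (ℕₚ.+-identityʳ r)) (≡.sym (ℕₚ.n≡⌈n+n/2⌉ r))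

module RingIdentities {c ℓ : Level} (R : CommutativeRing c ℓ) where
  almostRing : AlmostCommutativeRing c ℓ
  almostRing = fromCommutativeRing R (λ _ → nothing)
  open AlmostCommutativeRing almostRing

  [a-b]-[c-d] : ∀ a b c d → (a - b) - (c - d) ≈ (a - c) - (b - d)
  [a-b]-[c-d] = RingSolver.solve-∀ almostRing

module RingSums {c ℓ : Level} (R : CommutativeRing c ℓ) where
  open CommutativeRing R renaming (Carrier to F) hiding (zero)
  open CommutativeSemigroupProperties +-commutativeSemigroup using (interchange)
  open import Relation.Binary.Reasoning.Setoid setoid

  sumL-cong : {A : Set} (xs : List A) {f g : A → F} → (∀ a → f a ≈ g a) → sumL R xs f ≈ sumL R xs g
  sumL-cong [] f≈g = refl
  sumL-cong (a ∷ xs) f≈g = +-cong (f≈g a) (sumL-cong xs f≈g)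

  sumL-++ : {A : Set} (xs ys : List A) (f : A → F) → sumL R (xs ++ ys) f ≈ sumL R xs f + sumL R ys f
  sumL-++ [] ys f = sym (+-identityˡ _)
  sumL-++ (a ∷ xs) ys f = trans (+-congˡ (sumL-++ xs ys f)) (sym (+-assoc _ _ _))

  sumL-map : {A B : Set} (g : A → B) (xs : List A) (f : B → F) → sumL R (map g xs) f ≡ sumL R xs (f ∘ g)
  sumL-map g [] f = ≡.refl
  sumL-map g (a ∷ xs) f = ≡.cong (f (g a) +_) (sumL-map g xs f)

  sumL-vanish : {A : Set} (xs : List A) {f : A → F} → (∀ a → f a ≈ 0#) → sumL R xs f ≈ 0#
  sumL-vanish [] f≈0 = refl
  sumL-vanish (a ∷ xs) f≈0 = trans (+-cong (f≈0 a) (sumL-vanish xs f≈0)) (+-identityˡ _)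

  sumTo-cong : ∀ N {f g : ℕ → F} → (∀ i → f i ≈ g i) → sumTo R N f ≈ sumTo R N g
  sumTo-cong zero f≈g = f≈g 0
  sumTo-cong (suc N) f≈g = +-cong (f≈g (suc N)) (sumTo-cong N f≈g)

  sumTo-+ : ∀ N (f g : ℕ → F) → sumTo R N (λ i → f i + g i) ≈ sumTo R N f + sumTo R N g
  sumTo-+ zero f g = refl
  sumTo-+ (suc N) f g = trans (+-congˡ (sumTo-+ N f g)) (interchange _ _ _ _)

  sumTo-*ʳ : ∀ N (f : ℕ → F) a → sumTo R N f * a ≈ sumTo R N (λ i → f i * a)
  sumTo-*ʳ zero f a = refl
  sumTo-*ʳ (suc N) f a = trans (distribʳ a _ _) (+-congˡ (sumTo-*ʳ N f a))

  sumTo-suc : ∀ N (f : ℕ → F) → sumTo R (suc N) f ≈ f 0 + sumTo R N (f ∘ suc)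
  sumTo-suc zero f = +-comm _ _
  sumTo-suc (suc N) f = begin
    f (suc (suc N)) + sumTo R (suc N) f               ≈⟨ +-congˡ (sumTo-suc N f) ⟩
    f (suc (suc N)) + (f 0 + sumTo R N (f ∘ suc))     ≈⟨ sym (+-assoc _ _ _) ⟩
    (f (suc (suc N)) + f 0) + sumTo R N (f ∘ suc)     ≈⟨ +-congʳ (+-comm _ _) ⟩
    (f 0 + f (suc (suc N))) + sumTo R N (f ∘ suc)     ≈⟨ +-assoc _ _ _ ⟩
    f 0 + sumTo R (suc N) (f ∘ suc)                   ∎

  sumTo-vanish : ∀ N (f : ℕ → F) → (∀ i → i ≤ N → f i ≈ 0#) → sumTo R N f ≈ 0#
  sumTo-vanish zero f f≈0 = f≈0 0 z≤n
  sumTo-vanish (suc N) f f≈0 = trans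
    (+-cong (f≈0 (suc N) ℕₚ.≤-refl) (sumTo-vanish N f (λ i i≤N → f≈0 i (ℕₚ.m≤n⇒m≤1+n i≤N))))
    (+-identityˡ _)

  sumTo-single : ∀ N (f : ℕ → F) {k} → k ≤ N → (∀ i → i ≢ k → f i ≈ 0#) → sumTo R N f ≈ f k
  sumTo-single zero f z≤n f≈0 = refl
  sumTo-single (suc N) f {k} k≤1+N f≈0 with k ≟ suc N
  ... | yes ≡.refl = trans (+-congˡ (sumTo-vanish N f (λ i i≤N → f≈0 i (ℕₚ.<⇒≢ (s≤s i≤N))))) (+-identityʳ _)
  ... | no k≢1+N = begin
    f (suc N) + sumTo R N f  ≈⟨ +-congʳ (f≈0 (suc N) (k≢1+N ∘ ≡.sym)) ⟩
    0# + sumTo R N f         ≈⟨ +-identityˡ _ ⟩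
    sumTo R N f              ≈⟨ sumTo-single N f (ℕₚ.≤-pred (ℕₚ.≤∧≢⇒< k≤1+N k≢1+N)) f≈0 ⟩
    f k                      ∎

module Newton {c ℓ : Level} (R : CommutativeRing c ℓ) where
  open CommutativeRing R renaming (Carrier to F) hiding (zero)
  open import Relation.Binary.Reasoning.Setoid setoid
  open RingSums R
  open RingIdentities R using ([a-b]-[c-d])
  open AbelianGroupProperties +-abelianGroup using (xyx⁻¹≈y)

  b+[a-b] : ∀ a b → b + (a - b) ≈ a
  b+[a-b] a b = trans (sym (+-assoc b a (- b))) (xyx⁻¹≈y b a)

  ℕ→F-+ : ∀ a b → ℕ→F R (a ℕ.+ b) ≈ ℕ→F R a + ℕ→F R b
  ℕ→F-+ zero b = sym (+-identityˡ _)
  ℕ→F-+ (suc a) b = trans (+-congˡ (ℕ→F-+ a b)) (sym (+-assoc _ _ _))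

  Δ₀ : ℕ → (ℕ → F) → F
  Δ₀ zero f = f 0
  Δ₀ (suc l) f = Δ₀ l (λ t → f (suc t) - f t)

  Δ₀-cong : ∀ l {f g : ℕ → F} → (∀ t → f t ≈ g t) → Δ₀ l f ≈ Δ₀ l g
  Δ₀-cong zero f≈g = f≈g 0
  Δ₀-cong (suc l) f≈g = Δ₀-cong l (λ t → +-cong (f≈g (suc t)) (-‿cong (f≈g t)))

  Δ₀-sub : ∀ l (f g : ℕ → F) → Δ₀ l (λ t → f t - g t) ≈ Δ₀ l f - Δ₀ l g
  Δ₀-sub zero f g = refl
  Δ₀-sub (suc l) f g = trans
    (Δ₀-cong l (λ t → [a-b]-[c-d] (f (suc t)) (g (suc t)) (f t) (g t)))
    (Δ₀-sub l (λ t → f (suc t) - f t) (λ t → g (suc t) - g t))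

  Δ₀-shift : ∀ l (f : ℕ → F) → Δ₀ l (f ∘ suc) ≈ Δ₀ l f + Δ₀ (suc l) f
  Δ₀-shift l f = sym (trans (+-congˡ (Δ₀-sub l (f ∘ suc) f)) (b+[a-b] (Δ₀ l (f ∘ suc)) (Δ₀ l f)))

  binomial : ℕ → ℕ → F
  binomial p l = ℕ→F R (p C l)

  newtonSum : (ℕ → F) → ℕ → ℕ → F
  newtonSum f N p = sumTo R N (λ l → Δ₀ l f * binomial p l)

  newtonSum-suc : ∀ (f : ℕ → F) N p → p ≤ N → newtonSum f (suc N) (suc p) ≈ newtonSum (f ∘ suc) N p
  newtonSum-suc f N p p≤N = begin
    newtonSum f (suc N) (suc p)
      ≈⟨ sumTo-suc N _ ⟩
    Δ₀ 0 f * binomial p 0 + sumTo R N (λ l → Δ₀ (suc l) f * binomial (suc p) (suc l))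
      ≈⟨ +-congˡ (sumTo-cong N pascal) ⟩
    Δ₀ 0 f * binomial p 0 + sumTo R N (λ l → Δ₀ (suc l) f * binomial p (suc l) + Δ₀ (suc l) f * binomial p l)
      ≈⟨ +-congˡ (sumTo-+ N _ _) ⟩
    Δ₀ 0 f * binomial p 0 + (sumTo R N (λ l → Δ₀ (suc l) f * binomial p (suc l)) + higher)
      ≈⟨ sym (+-assoc _ _ _) ⟩
    (Δ₀ 0 f * binomial p 0 + sumTo R N (λ l → Δ₀ (suc l) f * binomial p (suc l))) + higher
      ≈⟨ +-congʳ (sym (sumTo-suc N _)) ⟩
    newtonSum f (suc N) p + higher
      ≈⟨ +-congʳ (trans (+-congʳ (trans (*-congˡ p<1+N) (zeroʳ _))) (+-identityˡ _)) ⟩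
    newtonSum f N p + higher
      ≈⟨ sym (sumTo-+ N _ _) ⟩
    sumTo R N (λ l → Δ₀ l f * binomial p l + Δ₀ (suc l) f * binomial p l)
      ≈⟨ sumTo-cong N (λ l → sym (trans (*-congʳ (Δ₀-shift l f)) (distribʳ _ _ _))) ⟩
    newtonSum (f ∘ suc) N p ∎
    where
    higher = sumTo R N (λ l → Δ₀ (suc l) f * binomial p l)
    p<1+N : binomial p (suc N) ≈ 0#
    p<1+N = reflexive (≡.cong (ℕ→F R) (k>n⇒nCk≡0 (s≤s p≤N)))
    pascal : ∀ l → Δ₀ (suc l) f * binomial (suc p) (suc l) ≈
                   Δ₀ (suc l) f * binomial p (suc l) + Δ₀ (suc l) f * binomial p l
    pascal l = begin
      Δ₀ (suc l) f * binomial (suc p) (suc l)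
        ≈⟨ *-congˡ (reflexive (≡.cong (ℕ→F R) (≡.sym (nCk+nC[k+1]≡[n+1]C[k+1] p l)))) ⟩
      Δ₀ (suc l) f * ℕ→F R (p C l ℕ.+ p C suc l)
        ≈⟨ *-congˡ (trans (ℕ→F-+ (p C l) (p C suc l)) (+-comm _ _)) ⟩
      Δ₀ (suc l) f * (binomial p (suc l) + binomial p l)
        ≈⟨ distribˡ _ _ _ ⟩
      Δ₀ (suc l) f * binomial p (suc l) + Δ₀ (suc l) f * binomial p l ∎

  newton-forward : ∀ (f : ℕ → F) N p → p ≤ N → f p ≈ newtonSum f N p
  newton-forward f N zero _ = sym (begin
    newtonSum f N 0          ≈⟨ sumTo-single N _ z≤n vanish ⟩
    f 0 * (1# + 0#)          ≈⟨ *-congˡ (+-identityʳ 1#) ⟩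
    f 0 * 1#                 ≈⟨ *-identityʳ _ ⟩
    f 0                      ∎)
    where
    vanish : ∀ l → l ≢ 0 → Δ₀ l f * binomial 0 l ≈ 0#
    vanish zero l≢0 = ⊥-elim (l≢0 ≡.refl)
    vanish (suc l) _ = zeroʳ _
  newton-forward f (suc N) (suc p) (s≤s p≤N) =
    trans (newton-forward (f ∘ suc) N p p≤N) (sym (newtonSum-suc f N p p≤N))

  newton-forward₂ : ∀ (f : ℕ → ℕ → F) A B p q → p ≤ A → q ≤ B →
    f p q ≈ sumTo R A (λ l → sumTo R B (λ s →
              Δ₀ s (λ q′ → Δ₀ l (λ p′ → f p′ q′)) * (binomial p l * binomial q s)))
  newton-forward₂ f A B p q p≤A q≤B = trans (newton-forward (λ p′ → f p′ q) A p p≤A) (sumTo-cong A λ l → begin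
    Δ₀ l (λ p′ → f p′ q) * binomial p l
      ≈⟨ *-congʳ (newton-forward (λ q′ → Δ₀ l (λ p′ → f p′ q′)) B q q≤B) ⟩
    newtonSum (λ q′ → Δ₀ l (λ p′ → f p′ q′)) B q * binomial p l
      ≈⟨ sumTo-*ʳ B _ _ ⟩
    sumTo R B (λ s → Δ₀ s (λ q′ → Δ₀ l (λ p′ → f p′ q′)) * binomial q s * binomial p l)
      ≈⟨ sumTo-cong B (λ s → trans (*-assoc _ _ _) (*-congˡ (*-comm _ _))) ⟩
    sumTo R B (λ s → Δ₀ s (λ q′ → Δ₀ l (λ p′ → f p′ q′)) * (binomial p l * binomial q s)) ∎)

module MiddleSums {c ℓ : Level} (R : CommutativeRing c ℓ) where
  open CommutativeRing R renaming (Carrier to F) hiding (zero)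
  open CommutativeSemigroupProperties +-commutativeSemigroup using (interchange)
  open import Relation.Binary.Reasoning.Setoid setoid
  open RingSums R

  -- For the columns of (x, y, z), sums G over all w of the tallies of (x, y, w) and (x, w, z),
  -- choosing the w-bit of each column in turn.
  extend : (Tally 3 → Tally 3 → F) → Letter 3 → Bool → Tally 3 → Tally 3 → F
  extend G (α ∷ β ∷ γ ∷ []) ε u v = G (insert (α ∷ β ∷ ε ∷ []) u) (insert (α ∷ ε ∷ γ ∷ []) v)

  splitSum : List (Letter 3) → (Tally 3 → Tally 3 → F) → F
  splitSum [] G = G empty empty
  splitSum (a ∷ L) G = splitSum L (extend G a true) + splitSum L (extend G a false)

  splitSum-cong : ∀ L {G H : Tally 3 → Tally 3 → F} → (∀ u v → G u v ≈ H u v) → splitSum L G ≈ splitSum L H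
  splitSum-cong [] G≈H = G≈H empty empty
  splitSum-cong ((α ∷ β ∷ γ ∷ []) ∷ L) G≈H =
    +-cong (splitSum-cong L (λ u v → G≈H _ _)) (splitSum-cong L (λ u v → G≈H _ _))

  extend-comm : ∀ G a b α β u v → extend (extend G a α) b β u v ≡ extend (extend G b β) a α u v
  extend-comm G (a₁ ∷ a₂ ∷ a₃ ∷ []) (b₁ ∷ b₂ ∷ b₃ ∷ []) α β u v = ≡.cong₂ G
    (insert-comm (a₁ ∷ a₂ ∷ α ∷ []) (b₁ ∷ b₂ ∷ β ∷ []) u)
    (insert-comm (a₁ ∷ α ∷ a₃ ∷ []) (b₁ ∷ β ∷ b₃ ∷ []) v)

  splitSum-↭ : ∀ {L L′} → L ↭ L′ → ∀ G → splitSum L G ≈ splitSum L′ G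
  splitSum-↭ ↭-refl G = refl
  splitSum-↭ (prep a L↭L′) G = +-cong (splitSum-↭ L↭L′ _) (splitSum-↭ L↭L′ _)
  splitSum-↭ (↭-trans L↭L′ L′↭L″) G = trans (splitSum-↭ L↭L′ G) (splitSum-↭ L′↭L″ G)
  splitSum-↭ {a ∷ b ∷ L} {_ ∷ _ ∷ L′} (swap _ _ L↭L′) G = trans
    (+-cong (+-cong (swapped true true) (swapped true false))
            (+-cong (swapped false true) (swapped false false)))
    (interchange _ _ _ _)
    where
    swapped : ∀ α β → splitSum L (extend (extend G a α) b β) ≈ splitSum L′ (extend (extend G b β) a α)
    swapped α β = trans (splitSum-↭ L↭L′ _) (splitSum-cong L′ (λ u v → reflexive (extend-comm G a b α β u v)))

  sum-middle : ∀ {k} (x y z : Subset k) G →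
    sumL R (allSubsets k) (λ w → G (venn x y w) (venn x w z)) ≈ splitSum (columns x y z) G
  sum-middle [] [] [] G = +-identityʳ _
  sum-middle {suc k} (a ∷ x) (b ∷ y) (c ∷ z) G = begin
    sumL R (map (true ∷_) (allSubsets k) ++ map (false ∷_) (allSubsets k)) summand
      ≈⟨ sumL-++ (map (true ∷_) (allSubsets k)) _ summand ⟩
    sumL R (map (true ∷_) (allSubsets k)) summand + sumL R (map (false ∷_) (allSubsets k)) summand
      ≈⟨ +-cong (reflexive (sumL-map (true ∷_) (allSubsets k) summand))
                (reflexive (sumL-map (false ∷_) (allSubsets k) summand)) ⟩
    sumL R (allSubsets k) (summand ∘ (true ∷_)) + sumL R (allSubsets k) (summand ∘ (false ∷_))
      ≈⟨ +-cong (sum-middle x y z _) (sum-middle x y z _) ⟩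
    splitSum (columns (a ∷ x) (b ∷ y) (c ∷ z)) G ∎
    where
    summand : Subset (suc k) → F
    summand w = G (venn (a ∷ x) (b ∷ y) w) (venn (a ∷ x) w (c ∷ z))

  sum-middle-venn : ∀ {k} (x y z : Subset k) G →
    sumL R (allSubsets k) (λ w → G (venn x y w) (venn x w z)) ≈ splitSum (elements (venn x y z)) G
  sum-middle-venn x y z G = trans (sum-middle x y z G) (splitSum-↭ (↭-elements-tally (columns x y z)) G)

module Terwilliger {c ℓ : Level} (R : CommutativeRing c ℓ) (n m : ℕ) (x : Subset n) (∣x∣≡m : ∣ x ∣ ≡ m) where
  open CommutativeRing R renaming (Carrier to F) hiding (zero)
  open RingSums R
  open Newton R using (Δ₀; binomial; newton-forward₂)
  open MiddleSums R using (splitSum; sum-middle-venn)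
  open J R n m x
  open ℕₚ using (m∸[m∸n]≡n; m+n∸m≡n; +-∸-assoc; *-monoʳ-≤; m∸n≤m; m≤n⇒m≤1+n)

  VertexSize : ℕ → Set
  VertexSize s = s ≡ m ⊎ s ≡ suc m

  vertexSize? : ∀ s → Dec (VertexSize s)
  vertexSize? s = (s ≟ m) ⊎-dec (s ≟ suc m)

  -- The matrices on X × X that are invariant under the stabiliser of x in Sym(Ω).
  record VennMatrix (P : Mat) : Set (c ⊔ ℓ) where
    field
      vanishesˡ : ∀ y z → ¬ VertexSize ∣ y ∣ → P y z ≈ 0#
      vanishesʳ : ∀ y z → ¬ VertexSize ∣ z ∣ → P y z ≈ 0#
      profile   : Tally 3 → F
      factors   : ∀ y z → P y z ≈ profile (venn x y z)

  open VennMatrix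

  VennMatrix-resp : ∀ {P Q} → P ≈M Q → VennMatrix P → VennMatrix Q
  VennMatrix-resp P≈Q V = record
    { vanishesˡ = λ y z y∉X → trans (sym (P≈Q y z)) (vanishesˡ V y z y∉X)
    ; vanishesʳ = λ y z z∉X → trans (sym (P≈Q y z)) (vanishesʳ V y z z∉X)
    ; profile   = profile V
    ; factors   = λ y z → trans (sym (P≈Q y z)) (factors V y z)
    }

  VennMatrix-+ : ∀ {P Q} → VennMatrix P → VennMatrix Q → VennMatrix (P +M Q)
  VennMatrix-+ V W = record
    { vanishesˡ = λ y z y∉X → trans (+-cong (vanishesˡ V y z y∉X) (vanishesˡ W y z y∉X)) (+-identityˡ _)
    ; vanishesʳ = λ y z z∉X → trans (+-cong (vanishesʳ V y z z∉X) (vanishesʳ W y z z∉X)) (+-identityˡ _)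
    ; profile   = λ t → profile V t + profile W t
    ; factors   = λ y z → +-cong (factors V y z) (factors W y z)
    }

  VennMatrix-• : ∀ a {P} → VennMatrix P → VennMatrix (a •M P)
  VennMatrix-• a V = record
    { vanishesˡ = λ y z y∉X → trans (*-congˡ (vanishesˡ V y z y∉X)) (zeroʳ a)
    ; vanishesʳ = λ y z z∉X → trans (*-congˡ (vanishesʳ V y z z∉X)) (zeroʳ a)
    ; profile   = λ t → a * profile V t
    ; factors   = λ y z → *-congˡ (factors V y z)
    }

  VennMatrix-· : ∀ {P Q} → VennMatrix P → VennMatrix Q → VennMatrix (P ·M Q)
  VennMatrix-· V W = record
    { vanishesˡ = λ y z y∉X → sumL-vanish (allSubsets n) (λ w → trans (*-congʳ (vanishesˡ V y w y∉X)) (zeroˡ _))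
    ; vanishesʳ = λ y z z∉X → sumL-vanish (allSubsets n) (λ w → trans (*-congˡ (vanishesʳ W w z z∉X)) (zeroʳ _))
    ; profile   = λ t → splitSum (elements t) (λ u v → profile V u * profile W v)
    ; factors   = λ y z → trans
        (sumL-cong (allSubsets n) (λ w → *-cong (factors V y w) (factors W w z)))
        (sum-middle-venn x y z _)
    }

  VennMatrix-sumTo : ∀ k (P : ℕ → Mat) → (∀ i → VennMatrix (P i)) →
    VennMatrix (λ y z → sumTo R k (λ i → P i y z))
  VennMatrix-sumTo k P V = record
    { vanishesˡ = λ y z y∉X → sumTo-vanish k _ (λ i _ → vanishesˡ (V i) y z y∉X)
    ; vanishesʳ = λ y z z∉X → sumTo-vanish k _ (λ i _ → vanishesʳ (V i) y z z∉X)
    ; profile   = λ t → sumTo R k (λ i → profile (V i) t)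
    ; factors   = λ y z → sumTo-cong k (λ i → factors (V i) y z)
    }

  record Stats : Set where
    constructor mkStats
    field ∣y∣ ∣z∣ ∣x∩y∣ ∣x∩z∣ ∣y─z∣ ∣z─y∣ ∣y∩z∩x∣ ∣y∩z─x∣ : ℕ

  statsBy : (Region → ℕ) → Stats
  statsBy sizeOf = mkStats (sizeOf ⟦y⟧) (sizeOf ⟦z⟧) (sizeOf ⟦x∩y⟧) (sizeOf ⟦x∩z⟧)
                           (sizeOf ⟦y─z⟧) (sizeOf ⟦z─y⟧) (sizeOf ⟦y∩z∩x⟧) (sizeOf ⟦y∩z─x⟧)

  stats : Subset n → Subset n → Stats
  stats y z = statsBy (λ S → ∣ S x y z ∣)

  statsOf : Tally 3 → Stats
  statsOf t = statsBy (λ S → size S t)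

  stats≡statsOf-venn : ∀ y z → stats y z ≡ statsOf (venn x y z)
  stats≡statsOf-venn y z = mkStats-cong
    (by-venn ⟦y⟧ λ _ _ _ _ _ _ → ≡.refl) (by-venn ⟦z⟧ λ _ _ _ _ _ _ → ≡.refl)
    (by-venn ⟦x∩y⟧ λ _ _ _ _ _ _ → ≡.refl) (by-venn ⟦x∩z⟧ λ _ _ _ _ _ _ → ≡.refl)
    (by-venn ⟦y─z⟧ λ _ _ _ _ _ _ → ≡.refl) (by-venn ⟦z─y⟧ λ _ _ _ _ _ _ → ≡.refl)
    (by-venn ⟦y∩z∩x⟧ λ _ _ _ _ _ _ → ≡.refl) (by-venn ⟦y∩z─x⟧ λ _ _ _ _ _ _ → ≡.refl)
    where
    by-venn : (S : Region) → Pointwise S → ∣ S x y z ∣ ≡ size S (venn x y z)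
    by-venn S S-∷ = ∣region∣≡size-venn S S-∷ x y z
    mkStats-cong : ∀ {a b c d e f g h a′ b′ c′ d′ e′ f′ g′ h′} →
      a ≡ a′ → b ≡ b′ → c ≡ c′ → d ≡ d′ → e ≡ e′ → f ≡ f′ → g ≡ g′ → h ≡ h′ →
      mkStats a b c d e f g h ≡ mkStats a′ b′ c′ d′ e′ f′ g′ h′
    mkStats-cong ≡.refl ≡.refl ≡.refl ≡.refl ≡.refl ≡.refl ≡.refl ≡.refl = ≡.refl

  when : {A : Set} → Dec A → F → F
  when (yes _) v = v
  when (no _) _ = 0#

  when-no : {A : Set} (d : Dec A) → ¬ A → ∀ v → when d v ≡ 0#
  when-no (yes a) ¬a v = ⊥-elim (¬a a)
  when-no (no _) _ v = ≡.refl

  when-yes : {A : Set} (d : Dec A) → A → ∀ v → when d v ≡ v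
  when-yes (yes _) _ v = ≡.refl
  when-yes (no ¬a) a v = ⊥-elim (¬a a)

  when-⇔ : {A B : Set} (a : Dec A) (b : Dec B) → (A → B) → (B → A) → ∀ v → when a v ≡ when b v
  when-⇔ (yes _) (yes _) _ _ v = ≡.refl
  when-⇔ (no _) (no _) _ _ v = ≡.refl
  when-⇔ (yes a) (no ¬b) A→B _ v = ⊥-elim (¬b (A→B a))
  when-⇔ (no ¬a) (yes b) _ B→A v = ⊥-elim (¬a (B→A b))

  VennMatrix-when : ∀ {P} {A : Stats → Set} (A? : ∀ s → Dec (A s)) (v : Stats → F) →
    (∀ s → A s → VertexSize (Stats.∣y∣ s) × VertexSize (Stats.∣z∣ s)) →
    (∀ y z → P y z ≡ when (A? (stats y z)) (v (stats y z))) → VennMatrix P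
  VennMatrix-when A? v A⇒X P≡ = record
    { vanishesˡ = λ y z y∉X → reflexive (≡.trans (P≡ y z) (when-no (A? _) (y∉X ∘ proj₁ ∘ A⇒X _) _))
    ; vanishesʳ = λ y z z∉X → reflexive (≡.trans (P≡ y z) (when-no (A? _) (z∉X ∘ proj₂ ∘ A⇒X _) _))
    ; profile   = λ t → when (A? (statsOf t)) (v (statsOf t))
    ; factors   = λ y z → reflexive
        (≡.trans (P≡ y z) (≡.cong (λ s → when (A? s) (v s)) (stats≡statsOf-venn y z)))
    }

  levelOf : ℕ → ℕ → ℕ
  levelOf ∣y∣ ∣x∩y∣ with ∣y∣ ≟ m
  ... | yes _ = 2 ℕ.* (m ∸ ∣x∩y∣)
  ... | no _ = suc (2 ℕ.* (m ∸ ∣x∩y∣))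

  level≡levelOf : ∀ y → level y ≡ levelOf ∣ y ∣ ∣ x ∩ y ∣
  level≡levelOf y with ∣ y ∣ ≟ m
  ... | yes _ = ≡.refl
  ... | no _ = ≡.refl

  InΓ : ℕ → Subset n → Set
  InΓ k y = VertexSize ∣ y ∣ × level y ≡ k

  InΓ-sizes : ℕ → ℕ → ℕ → Set
  InΓ-sizes k ∣y∣ ∣x∩y∣ = VertexSize ∣y∣ × levelOf ∣y∣ ∣x∩y∣ ≡ k

  inΓ-sizes? : ∀ k ∣y∣ ∣x∩y∣ → Dec (InΓ-sizes k ∣y∣ ∣x∩y∣)
  inΓ-sizes? k ∣y∣ ∣x∩y∣ = vertexSize? ∣y∣ ×-dec (levelOf ∣y∣ ∣x∩y∣ ≟ k)

  InΓ⇒InΓ-sizes : ∀ {k} y → InΓ k y → InΓ-sizes k ∣ y ∣ ∣ x ∩ y ∣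
  InΓ⇒InΓ-sizes y = Product.map₂ (≡.trans (≡.sym (level≡levelOf y)))

  InΓ-sizes⇒InΓ : ∀ {k} y → InΓ-sizes k ∣ y ∣ ∣ x ∩ y ∣ → InΓ k y
  InΓ-sizes⇒InΓ y = Product.map₂ (≡.trans (level≡levelOf y))

  Adjacent : Stats → Set
  Adjacent s = (∣y∣ ≡ m × ∣z∣ ≡ suc m × ∣y─z∣ ≡ 0) ⊎ (∣y∣ ≡ suc m × ∣z∣ ≡ m × ∣z─y∣ ≡ 0)
    where open Stats s

  adjacent? : ∀ s → Dec (Adjacent s)
  adjacent? s = ((∣y∣ ≟ m) ×-dec (∣z∣ ≟ suc m) ×-dec (∣y─z∣ ≟ 0))
                ⊎-dec ((∣y∣ ≟ suc m) ×-dec (∣z∣ ≟ m) ×-dec (∣z─y∣ ≟ 0))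
    where open Stats s

  AdjacentSets : Subset n → Subset n → Set
  AdjacentSets y z = (∣ y ∣ ≡ m × ∣ z ∣ ≡ suc m × y ⊆ z) ⊎ (∣ y ∣ ≡ suc m × ∣ z ∣ ≡ m × z ⊆ y)

  adjacentSets? : ∀ y z → Dec (AdjacentSets y z)
  adjacentSets? y z = ((∣ y ∣ ≟ m) ×-dec (∣ z ∣ ≟ suc m) ×-dec (y ⊆? z))
                      ⊎-dec ((∣ y ∣ ≟ suc m) ×-dec (∣ z ∣ ≟ m) ×-dec (z ⊆? y))

  adjA≡when : ∀ y z → adjA y z ≡ when (adjacentSets? y z) 1#
  adjA≡when y z with adjacentSets? y z
  ... | yes _ = ≡.refl
  ... | no _ = ≡.refl

  VennMatrix-adjA : VennMatrix adjA
  VennMatrix-adjA = VennMatrix-when {A = Adjacent} adjacent? (λ _ → 1#) adjacent⇒X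
    (λ y z → ≡.trans (adjA≡when y z)
       (when-⇔ (adjacentSets? y z) (adjacent? (stats y z)) (⊆⇒adjacent y z) (adjacent⇒⊆ y z) 1#))
    where
    adjacent⇒X : ∀ s → Adjacent s → VertexSize (Stats.∣y∣ s) × VertexSize (Stats.∣z∣ s)
    adjacent⇒X _ (inj₁ (y≡m , z≡1+m , _)) = inj₁ y≡m , inj₂ z≡1+m
    adjacent⇒X _ (inj₂ (y≡1+m , z≡m , _)) = inj₂ y≡1+m , inj₁ z≡m
    ⊆⇒adjacent : ∀ y z → AdjacentSets y z → Adjacent (stats y z)
    ⊆⇒adjacent y z = Sum.map (Product.map₂ (Product.map₂ (p⊆q⇒∣p─q∣≡0 y z)))
                             (Product.map₂ (Product.map₂ (p⊆q⇒∣p─q∣≡0 z y)))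
    adjacent⇒⊆ : ∀ y z → Adjacent (stats y z) → AdjacentSets y z
    adjacent⇒⊆ y z = Sum.map (Product.map₂ (Product.map₂ (∣p─q∣≡0⇒p⊆q y z)))
                             (Product.map₂ (Product.map₂ (∣p─q∣≡0⇒p⊆q z y)))

  OnDiagonal : (Stats → Set) → Stats → Set
  OnDiagonal A s = (A s × VertexSize ∣z∣) × ∣y─z∣ ℕ.+ ∣z─y∣ ≡ 0
    where open Stats s

  VennMatrix-diagonal : ∀ {P} {B : Subset n → Set} (B? : ∀ y → Dec (B y))
    {A : Stats → Set} (A? : ∀ s → Dec (A s)) →
    (∀ y z → B y → A (stats y z)) → (∀ y z → A (stats y z) → B y) → (∀ s → A s → VertexSize (Stats.∣y∣ s)) →
    (∀ y z → P y z ≡ when (B? y ×-dec eqSub? y z) 1#) → VennMatrix P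
  VennMatrix-diagonal {B = B} B? {A} A? B⇒A A⇒B A⇒X P≡ =
    VennMatrix-when {A = OnDiagonal A} onDiagonal? (λ _ → 1#) (λ s ((a , z∈X) , _) → A⇒X s a , z∈X)
      (λ y z → ≡.trans (P≡ y z)
         (when-⇔ (B? y ×-dec eqSub? y z) (onDiagonal? (stats y z)) (to y z) (from y z) 1#))
    where
    onDiagonal? : ∀ s → Dec (OnDiagonal A s)
    onDiagonal? s = (A? s ×-dec vertexSize? (Stats.∣z∣ s)) ×-dec (Stats.∣y─z∣ s ℕ.+ Stats.∣z─y∣ s ≟ 0)
    to : ∀ y z → B y × y ≡ z → OnDiagonal A (stats y z)
    to y z (b , ≡.refl) = (B⇒A y y b , A⇒X _ (B⇒A y y b)) , ≡.cong₂ ℕ._+_ (∣p─p∣≡0 y) (∣p─p∣≡0 y)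
    from : ∀ y z → OnDiagonal A (stats y z) → B y × y ≡ z
    from y z ((a , _) , e) = A⇒B y z a , ∣p─q∣+∣q─p∣≡0⇒p≡q y z e

  idX≡when : ∀ y z → idX y z ≡ when (inX? y ×-dec eqSub? y z) 1#
  idX≡when y z with inX? y | eqSub? y z
  ... | yes _ | yes _ = ≡.refl
  ... | yes _ | no _ = ≡.refl
  ... | no _ | _ = ≡.refl

  Estar≡when : ∀ k y z → Estar k y z ≡ when (inΓ? k y ×-dec eqSub? y z) 1#
  Estar≡when k y z with inΓ? k y | eqSub? y z
  ... | yes _ | yes _ = ≡.refl
  ... | yes _ | no _ = ≡.refl
  ... | no _ | _ = ≡.refl

  VennMatrix-idX : VennMatrix idX
  VennMatrix-idX = VennMatrix-diagonal inX? (λ s → vertexSize? (Stats.∣y∣ s))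
    (λ _ _ y∈X → y∈X) (λ _ _ y∈X → y∈X) (λ _ y∈X → y∈X) idX≡when

  VennMatrix-Estar : ∀ k → VennMatrix (Estar k)
  VennMatrix-Estar k = VennMatrix-diagonal (inΓ? k) (λ s → inΓ-sizes? k (Stats.∣y∣ s) (Stats.∣x∩y∣ s))
    (λ y _ → InΓ⇒InΓ-sizes y) (λ y _ → InΓ-sizes⇒InΓ y) (λ _ → proj₁) (Estar≡when k)

  basis≡when : ∀ i j l s y z → basis i j l s y z ≡
    when (inΓ? i y ×-dec inΓ? j z) (binomial (∣ (y ∩ x) ∩ (z ∩ x) ∣) l * binomial (∣ (y ─ x) ∩ (z ─ x) ∣) s)
  basis≡when i j l s y z with inΓ? i y | inΓ? j z
  ... | yes _ | yes _ = ≡.refl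
  ... | yes _ | no _ = ≡.refl
  ... | no _ | _ = ≡.refl

  VennMatrix-basis : ∀ i j l s → VennMatrix (basis i j l s)
  VennMatrix-basis i j l s = VennMatrix-when {A = InΓ-sizes²} inΓ-sizes²?
    (λ t → binomial (∣y∩z∩x∣ t) l * binomial (∣y∩z─x∣ t) s)
    (λ _ ((y∈X , _) , (z∈X , _)) → y∈X , z∈X)
    (λ y z → ≡.trans (basis≡when i j l s y z) (when-⇔ (inΓ? i y ×-dec inΓ? j z) (inΓ-sizes²? (stats y z))
       (Product.map (InΓ⇒InΓ-sizes y) (InΓ⇒InΓ-sizes z))
       (Product.map (InΓ-sizes⇒InΓ y) (InΓ-sizes⇒InΓ z)) _))
    where
    open Stats
    InΓ-sizes² : Stats → Set
    InΓ-sizes² t = InΓ-sizes i (∣y∣ t) (∣x∩y∣ t) × InΓ-sizes j (∣z∣ t) (∣x∩z∣ t)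
    inΓ-sizes²? : ∀ t → Dec (InΓ-sizes² t)
    inΓ-sizes²? t = inΓ-sizes? i (∣y∣ t) (∣x∩y∣ t) ×-dec inΓ-sizes? j (∣z∣ t) (∣x∩z∣ t)

  VennMatrix-InT : ∀ {P} → InT P → VennMatrix P
  VennMatrix-InT genA = VennMatrix-adjA
  VennMatrix-InT (genE k _) = VennMatrix-Estar k
  VennMatrix-InT genI = VennMatrix-idX
  VennMatrix-InT (add P Q) = VennMatrix-+ (VennMatrix-InT P) (VennMatrix-InT Q)
  VennMatrix-InT (scal a P) = VennMatrix-• a (VennMatrix-InT P)
  VennMatrix-InT (mul P Q) = VennMatrix-· (VennMatrix-InT P) (VennMatrix-InT Q)
  VennMatrix-InT (resp P≈Q P) = VennMatrix-resp P≈Q (VennMatrix-InT P)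

  maxLevel : ℕ
  maxLevel = suc (2 ℕ.* m)

  maxˡ maxˢ : ℕ → ℕ → ℕ
  maxˡ i j = (m ∸ ⌊ i /2⌋) ⊓ (m ∸ ⌊ j /2⌋)
  maxˢ i j = ⌈ i /2⌉ ⊓ ⌈ j /2⌉

  block : (ℕ → ℕ → ℕ → ℕ → F) → ℕ → ℕ → Mat
  block coef i j y z = sumTo R (maxˡ i j) λ l → sumTo R (maxˢ i j) λ s → coef i j l s * basis i j l s y z

  spanned : (ℕ → ℕ → ℕ → ℕ → F) → Mat
  spanned coef y z = sumTo R maxLevel λ i → sumTo R maxLevel λ j → block coef i j y z

  VennMatrix-spanned : ∀ coef → VennMatrix (spanned coef)
  VennMatrix-spanned coef =
    VennMatrix-sumTo maxLevel _ λ i → VennMatrix-sumTo maxLevel _ λ j →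
    VennMatrix-sumTo (maxˡ i j) _ λ l → VennMatrix-sumTo (maxˢ i j) _ λ s →
    VennMatrix-• (coef i j l s) (VennMatrix-basis i j l s)

  VennMatrix-InM : ∀ {P} → InM P → VennMatrix P
  VennMatrix-InM (coef , P≈spanned) =
    VennMatrix-resp (λ y z → sym (P≈spanned y z)) (VennMatrix-spanned coef)

  ∣x∩y∣≤m : ∀ y → ∣ x ∩ y ∣ ≤ m
  ∣x∩y∣≤m y = ≡.subst (∣ x ∩ y ∣ ≤_) ∣x∣≡m (∣p∩q∣≤∣p∣ x y)

  ⌊level/2⌋ : ∀ y → ⌊ level y /2⌋ ≡ m ∸ ∣ x ∩ y ∣
  ⌊level/2⌋ y with ∣ y ∣ ≟ m
  ... | yes _ = ⌊2r/2⌋≡r (m ∸ ∣ x ∩ y ∣)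
  ... | no _ = ⌈2r/2⌉≡r (m ∸ ∣ x ∩ y ∣)

  ⌈level/2⌉ : ∀ y → VertexSize ∣ y ∣ → ⌈ level y /2⌉ ≡ ∣ y ∣ ∸ ∣ x ∩ y ∣
  ⌈level/2⌉ y y∈X with ∣ y ∣ ≟ m | y∈X
  ... | yes ∣y∣≡m | _ = ≡.trans (⌈2r/2⌉≡r (m ∸ ∣ x ∩ y ∣)) (≡.cong (_∸ ∣ x ∩ y ∣) (≡.sym ∣y∣≡m))
  ... | no ∣y∣≢m | inj₁ ∣y∣≡m = ⊥-elim (∣y∣≢m ∣y∣≡m)
  ... | no _ | inj₂ ∣y∣≡1+m = begin
    suc ⌊ 2 ℕ.* (m ∸ ∣ x ∩ y ∣) /2⌋  ≡⟨ ≡.cong suc (⌊2r/2⌋≡r (m ∸ ∣ x ∩ y ∣)) ⟩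
    suc (m ∸ ∣ x ∩ y ∣)             ≡⟨ ≡.sym (+-∸-assoc 1 (∣x∩y∣≤m y)) ⟩
    suc m ∸ ∣ x ∩ y ∣               ≡⟨ ≡.cong (_∸ ∣ x ∩ y ∣) (≡.sym ∣y∣≡1+m) ⟩
    ∣ y ∣ ∸ ∣ x ∩ y ∣               ∎
    where open ≡.≡-Reasoning

  m∸⌊level/2⌋ : ∀ y → m ∸ ⌊ level y /2⌋ ≡ ∣ x ∩ y ∣
  m∸⌊level/2⌋ y = ≡.trans (≡.cong (m ∸_) (⌊level/2⌋ y)) (m∸[m∸n]≡n (∣x∩y∣≤m y))

  ⌈level/2⌉≡∣y─x∣ : ∀ y → VertexSize ∣ y ∣ → ⌈ level y /2⌉ ≡ ∣ y ─ x ∣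
  ⌈level/2⌉≡∣y─x∣ y y∈X = ≡.trans (⌈level/2⌉ y y∈X)
    (≡.trans (≡.cong (_∸ ∣ x ∩ y ∣) (∣q∣≡∣p∩q∣+∣q─p∣ x y)) (m+n∸m≡n ∣ x ∩ y ∣ ∣ y ─ x ∣))

  level≤maxLevel : ∀ y → level y ≤ maxLevel
  level≤maxLevel y with ∣ y ∣ ≟ m
  ... | yes _ = m≤n⇒m≤1+n (*-monoʳ-≤ 2 (m∸n≤m m ∣ x ∩ y ∣))
  ... | no _ = s≤s (*-monoʳ-≤ 2 (m∸n≤m m ∣ x ∩ y ∣))

  cellsAt : ℕ → ℕ → ℕ → ℕ → Tally 3
  cellsAt i j p q = reconstruct m n (m ∸ ⌊ i /2⌋) (m ∸ ⌊ j /2⌋) ⌈ i /2⌉ ⌈ j /2⌉ p q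

  venn≡cellsAt : ∀ y z → VertexSize ∣ y ∣ → VertexSize ∣ z ∣ →
    venn x y z ≡ cellsAt (level y) (level z) ∣ (y ∩ x) ∩ (z ∩ x) ∣ ∣ (y ─ x) ∩ (z ─ x) ∣
  venn≡cellsAt y z y∈X z∈X = tally≡reconstruct (venn x y z)
    (≡.trans (size-venn ⟦x⟧ λ _ _ _ _ _ _ → ≡.refl) ∣x∣≡m)
    (≡.trans (size-venn ⟦Ω⟧ λ _ _ _ _ _ _ → ≡.refl) (∣⊤∣≡n n))
    (≡.trans (size-venn ⟦x∩y⟧ λ _ _ _ _ _ _ → ≡.refl) (≡.sym (m∸⌊level/2⌋ y)))
    (≡.trans (size-venn ⟦x∩z⟧ λ _ _ _ _ _ _ → ≡.refl) (≡.sym (m∸⌊level/2⌋ z)))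
    (≡.trans (size-venn ⟦y─x⟧ λ _ _ _ _ _ _ → ≡.refl) (≡.sym (⌈level/2⌉≡∣y─x∣ y y∈X)))
    (≡.trans (size-venn ⟦z─x⟧ λ _ _ _ _ _ _ → ≡.refl) (≡.sym (⌈level/2⌉≡∣y─x∣ z z∈X)))
    (size-venn ⟦y∩z∩x⟧ λ _ _ _ _ _ _ → ≡.refl)
    (size-venn ⟦y∩z─x⟧ λ _ _ _ _ _ _ → ≡.refl)
    where
    size-venn : (S : Region) → Pointwise S → size S (venn x y z) ≡ ∣ S x y z ∣
    size-venn S S-∷ = ≡.sym (∣region∣≡size-venn S S-∷ x y z)

  ∣y∩z∩x∣≤ : ∀ y z → ∣ (y ∩ x) ∩ (z ∩ x) ∣ ≤ (m ∸ ⌊ level y /2⌋) ⊓ (m ∸ ⌊ level z /2⌋)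
  ∣y∩z∩x∣≤ y z rewrite m∸⌊level/2⌋ y | m∸⌊level/2⌋ z | ∩-comm x y | ∩-comm x z =
    ∣p∩q∣≤∣p∣⊓∣q∣ (y ∩ x) (z ∩ x)

  ∣y∩z─x∣≤ : ∀ y z → VertexSize ∣ y ∣ → VertexSize ∣ z ∣ → ∣ (y ─ x) ∩ (z ─ x) ∣ ≤ ⌈ level y /2⌉ ⊓ ⌈ level z /2⌉
  ∣y∩z─x∣≤ y z y∈X z∈X rewrite ⌈level/2⌉≡∣y─x∣ y y∈X | ⌈level/2⌉≡∣y─x∣ z z∈X =
    ∣p∩q∣≤∣p∣⊓∣q∣ (y ─ x) (z ─ x)

  block-vanish : ∀ coef i j y z → ¬ (InΓ i y × InΓ j z) → block coef i j y z ≈ 0#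
  block-vanish coef i j y z ¬Γ =
    sumTo-vanish (maxˡ i j) _ λ l _ → sumTo-vanish (maxˢ i j) _ λ s _ →
    trans (*-congˡ (reflexive (≡.trans (basis≡when i j l s y z) (when-no (inΓ? i y ×-dec inΓ? j z) ¬Γ _))))
          (zeroʳ _)

  spanned-outside : ∀ coef y z → ¬ (VertexSize ∣ y ∣ × VertexSize ∣ z ∣) → spanned coef y z ≈ 0#
  spanned-outside coef y z ¬X =
    sumTo-vanish maxLevel _ λ i _ → sumTo-vanish maxLevel _ λ j _ →
    block-vanish coef i j y z (λ ((y∈X , _) , (z∈X , _)) → ¬X (y∈X , z∈X))

  spanned-inside : ∀ coef y z → VertexSize ∣ y ∣ → VertexSize ∣ z ∣ →
    spanned coef y z ≈
    sumTo R (maxˡ (level y) (level z)) λ l → sumTo R (maxˢ (level y) (level z)) λ s →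
    coef (level y) (level z) l s * (binomial (∣ (y ∩ x) ∩ (z ∩ x) ∣) l * binomial (∣ (y ─ x) ∩ (z ─ x) ∣) s)
  spanned-inside coef y z y∈X z∈X = begin
    spanned coef y z
      ≈⟨ sumTo-single maxLevel _ (level≤maxLevel y) (λ i i≢level → sumTo-vanish maxLevel _ λ j _ →
           block-vanish coef i j y z (λ ((_ , level≡i) , _) → i≢level (≡.sym level≡i))) ⟩
    sumTo R maxLevel (λ j → block coef (level y) j y z)
      ≈⟨ sumTo-single maxLevel _ (level≤maxLevel z) (λ j j≢level →
           block-vanish coef (level y) j y z (λ (_ , (_ , level≡j)) → j≢level (≡.sym level≡j))) ⟩
    block coef (level y) (level z) y z
      ≈⟨ sumTo-cong (maxˡ (level y) (level z)) (λ l → sumTo-cong (maxˢ (level y) (level z)) λ s →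
           *-congˡ (reflexive (≡.trans (basis≡when (level y) (level z) l s y z)
             (when-yes (inΓ? (level y) y ×-dec inΓ? (level z) z) ((y∈X , ≡.refl) , (z∈X , ≡.refl)) _)))) ⟩
    _ ∎
    where open import Relation.Binary.Reasoning.Setoid setoid

  InM-VennMatrix : ∀ {P} → VennMatrix P → InM P
  InM-VennMatrix {P} V = coef , P≈spanned
    where
    f : ℕ → ℕ → ℕ → ℕ → F
    f i j p q = profile V (cellsAt i j p q)
    coef : ℕ → ℕ → ℕ → ℕ → F
    coef i j l s = Δ₀ s (λ q → Δ₀ l (λ p → f i j p q))
    P≈spanned : P ≈M spanned coef
    P≈spanned y z = by-membership (vertexSize? ∣ y ∣) (vertexSize? ∣ z ∣)
      where
      open import Relation.Binary.Reasoning.Setoid setoid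
      by-membership : Dec (VertexSize ∣ y ∣) → Dec (VertexSize ∣ z ∣) → P y z ≈ spanned coef y z
      by-membership (no y∉X) _ =
        trans (vanishesˡ V y z y∉X) (sym (spanned-outside coef y z (y∉X ∘ proj₁)))
      by-membership (yes _) (no z∉X) =
        trans (vanishesʳ V y z z∉X) (sym (spanned-outside coef y z (z∉X ∘ proj₂)))
      by-membership (yes y∈X) (yes z∈X) = begin
        P y z                   ≈⟨ factors V y z ⟩
        profile V (venn x y z)  ≡⟨ ≡.cong (profile V) (venn≡cellsAt y z y∈X z∈X) ⟩
        f (level y) (level z) ∣ (y ∩ x) ∩ (z ∩ x) ∣ ∣ (y ─ x) ∩ (z ─ x) ∣
          ≈⟨ newton-forward₂ (f (level y) (level z)) _ _ _ _ (∣y∩z∩x∣≤ y z) (∣y∩z─x∣≤ y z y∈X z∈X) ⟩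
        _                       ≈⟨ sym (spanned-inside coef y z y∈X z∈X) ⟩
        spanned coef y z        ∎

open import Data.Nat using (_*_)

lemma3p1 : {c ℓ : Level} (R : CommutativeRing c ℓ) → IsCharZeroField R →
    (n m : ℕ) → 3 * m ≤ n → (x : Subset n) → ∣ x ∣ ≡ m →
    let open J R n m x in
    (InM idX × (∀ P Q → InM P → InM Q → InM (P ·M Q))) ×
    (∀ P → InT P → InM P)
lemma3p1 R _ n m _ x ∣x∣≡m =
  ( InM-VennMatrix VennMatrix-idX
  , λ _ _ P∈M Q∈M → InM-VennMatrix (VennMatrix-· (VennMatrix-InM P∈M) (VennMatrix-InM Q∈M)) )
  , λ _ P∈T → InM-VennMatrix (VennMatrix-InT P∈T)
  where open Terwilliger R n m x ∣x∣≡m
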